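{- Let $n > k > t > 0$ be integers. Define the $\binom{[n]}{k}\times\binom{[n]}{k}$ matrices $S(n,k,t)$ and $\Omega(n,k,t)$ as in the context below. Then \[S(n,k,t) = \Omega(n,k,t).\]
   Context: For integers $n>k>0$, $\binom{[n]}{k}$ denotes the family of $k$-element subsets of $[n]=\{1,\dots,n\}$. All matrices below have rows and columns indexed by $\binom{[n]}{k}$. For $0\le i\le k$, let $A_i$ be the matrix with $(A_i)_{F,F'}=1$ if $|F\cap F'|=k-i$ and $(A_i)_{F,F'}=0$ otherwise. For $0\le i\le k$, let $D_i$ be the matrix with $(D_i)_{\alpha,\beta}=\binom{|\alpha\setminus\beta|}{i}=\binom{k-|\alpha\cap\beta|}{i}$. Define \[a_{k-i} = \frac{1}{\binom{n-t}{k-t}}\binom{k}{k-i}\sum_{j=0}^{k-i}(-1)^{k-i-j}\binom{k-i}{j}\binom{n-\min(k-j,\,t)}{n-k},\] and \[S(n,k,t)=\sum_{i=0}^{t-1}\frac{a_{k-i}}{\binom{k}{k-i}\binom{n-k}{k-i}}A_{k-i},\] \[\Omega(n,k,t)=\sum_{i=0}^{t-1}(-1)^{t-1-i}\binom{k-1-i}{k-t}\binom{n-k-t+i}{k-t}^{ -1}D_{k-i}.\] -}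

module Defs where

open import Data.Nat using (ℕ; zero; suc; _∸_; _+_; _⊓_)
import Data.Nat as ℕ
open import Data.Nat.Combinatorics using (_C_)
open import Data.Integer using (+_)
open import Data.Rational using (ℚ; 0ℚ; 1ℚ; _/_; -_) renaming (_+_ to _+ℚ_; _*_ to _*ℚ_)
open import Data.Fin.Subset using (Subset; ∣_∣; _∩_)
open import Data.Product using (Σ; proj₁)
open import Relation.Binary.PropositionalEquality using (_≡_)
open import Relation.Nullary.Decidable using (does)
open import Data.Bool using (if_then_else_)

KSet : ℕ → ℕ → Set
KSet n k = Σ (Subset n) (λ F → ∣ F ∣ ≡ k)

Matrix : ℕ → ℕ → Set
Matrix n k = KSet n k → KSet n k → ℚ

inter : ∀ {n k} → KSet n k → KSet n k → ℕ
inter F G = ∣ proj₁ F ∩ proj₁ G ∣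

ℕ→ℚ : ℕ → ℚ
ℕ→ℚ m = + m / 1

-- reciprocal of a natural number, with the convention 1/0 = 0
invℕ : ℕ → ℚ
invℕ zero    = 0ℚ
invℕ (suc m) = + 1 / suc m

neg1^ : ℕ → ℚ
neg1^ zero    = 1ℚ
neg1^ (suc m) = - neg1^ m

sumℚ : ℕ → (ℕ → ℚ) → ℚ
sumℚ zero    f = 0ℚ
sumℚ (suc m) f = sumℚ m f +ℚ f m

A : (n k i : ℕ) → Matrix n k
A n k i F G = if does (inter F G ℕ.≟ (k ∸ i)) then 1ℚ else 0ℚ

D : (n k i : ℕ) → Matrix n k
D n k i F G = ℕ→ℚ ((k ∸ inter F G) C i)

-- a_m  (m = k - i in the paper's notation), for parameters n k t
a : (n k t m : ℕ) → ℚ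
a n k t m =
  invℕ ((n ∸ t) C (k ∸ t)) *ℚ ℕ→ℚ (k C m) *ℚ
    sumℚ (suc m) (λ j → neg1^ (m ∸ j) *ℚ ℕ→ℚ (m C j)
                         *ℚ ℕ→ℚ ((n ∸ ((k ∸ j) ⊓ t)) C (n ∸ k)))

S : (n k t : ℕ) → Matrix n k
S n k t F G = sumℚ t (λ i →
  a n k t (k ∸ i) *ℚ invℕ ((k C (k ∸ i)) ℕ.* ((n ∸ k) C (k ∸ i)))
    *ℚ A n k (k ∸ i) F G)

-- Ω(n,k,t) = Σ_{i=0}^{t-1} (-1)^{t-1-i} binom(k-1-i,k-t) binom(n-k-t+i,k-t)^{-1} D_{k-i}
-- (n-k-t+i is computed as (n+i) ∸ (k+t))
Ω : (n k t : ℕ) → Matrix n k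
Ω n k t F G = sumℚ t (λ i →
  neg1^ (t ∸ 1 ∸ i) *ℚ ℕ→ℚ ((k ∸ 1 ∸ i) C (k ∸ t))
    *ℚ invℕ (((n + i) ∸ (k + t)) C (k ∸ t))
    *ℚ D n k (k ∸ i) F G)

{-# OPTIONS --safe #-}
module Submission where

-- Write k = t + s and n = k + N, and let m = |F ∩ G| and r = k - m; then r ≤ N
-- because |F ∪ G| ≤ n.  If m ≥ t both entries vanish.  Otherwise S_{F,G} is
-- a_r / (binom(k, r) binom(N, r)), and a_r is binom(k, r) / binom(s + N, s) times
-- the r-th forward difference at 0 of f(j) = binom(s + N + (j - s)⁺, N).
-- Inverting the Pascal matrix gives Σ_l ω_l binom(X, l) = [s < X] for
-- ω_l = (-1)^(l-s-1) binom(l-1, s); with Vandermonde's identity this expands f in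
-- the functions j ↦ binom(N + j - l, N), whose r-th differences are
-- binom(N - l, N - r).  Trinomial revision turns the result into
-- Σ_l ω_l binom(r, l) / binom(s + N - l, s), which is Ω_{F,G} after substituting
-- l = k - i.

open import Defs
open import Algebra.Bundles using (CommutativeRing)
open import Data.Bool using (if_then_else_)
open import Data.Fin.Subset using (Subset; ∣_∣; _∩_; _∪_; inside; outside)
open import Data.Fin.Subset.Properties using (∣p∣≤n; ∣p∩q∣≤∣p∣)
open import Data.Integer using () renaming (+_ to pos)
import Data.Integer as ℤ
import Data.Integer.Properties as ℤP
open import Data.Nat as ℕ using (ℕ; zero; suc; _∸_; _≤_; _<_; z≤n; s≤s; _⊓_)
  renaming (_+_ to _+ₙ_; _*_ to _*ₙ_)
open import Data.Nat.Combinatorics using (_C_)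
import Data.Nat.Combinatorics as ℕC
import Data.Nat.Coprimality as Coprime
import Data.Nat.Properties as ℕP
open import Data.Nat.Tactic.RingSolver using () renaming (ring to ℕ-ring)
open import Data.Product using (_,_)
open import Data.Rational using (ℚ; 0ℚ; 1ℚ; mkℚ; -_; _+_; _-_; _*_; toℚᵘ)
open import Data.Rational.Properties
import Data.Rational.Unnormalised as ℚᵘ
import Data.Rational.Unnormalised.Properties as ℚᵘP
open import Data.Sum using (_⊎_; inj₁; inj₂; [_,_]′)
open import Data.Vec using ([]; _∷_)
open import Level using (0ℓ)
open import Relation.Binary.PropositionalEquality
open import Relation.Nullary using (Dec; ¬_)
open import Relation.Nullary.Decidable using (does; dec-true; dec-false; dec⇒maybe)
open import Tactic.RingSolver using (solve-∀)
open import Tactic.RingSolver.Core.AlmostCommutativeRing using (AlmostCommutativeRing; fromCommutativeRing)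

open import Algebra.Properties.CommutativeSemigroup
  (CommutativeRing.*-commutativeSemigroup +-*-commutativeRing) using (interchange)
open import Algebra.Properties.CommutativeSemigroup
  (CommutativeRing.+-commutativeSemigroup +-*-commutativeRing) using () renaming (interchange to +-interchange)

ℚ-ring : AlmostCommutativeRing 0ℓ 0ℓ
ℚ-ring = fromCommutativeRing +-*-commutativeRing (λ x → dec⇒maybe (0ℚ ≟ x))

ι : ℕ → ℚ
ι = ℕ→ℚ

ι≡mkℚ : ∀ m → ι m ≡ mkℚ (pos m) 0 (Coprime.sym (Coprime.1-coprimeTo m))
ι≡mkℚ m = normalize-coprime _

toℚᵘ-ι : ∀ m → toℚᵘ (ι m) ≡ ℚᵘ.mkℚᵘ (pos m) 0
toℚᵘ-ι m = cong toℚᵘ (ι≡mkℚ m)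

ι-homo-+ : ∀ a b → ι (a +ₙ b) ≡ ι a + ι b
ι-homo-+ a b = toℚᵘ-injective (begin
  toℚᵘ (ι (a +ₙ b))                         ≡⟨ toℚᵘ-ι (a +ₙ b) ⟩
  ℚᵘ.mkℚᵘ (pos (a +ₙ b)) 0                  ≈⟨ ℚᵘ.*≡* (cong (ℤ._* pos 1) numerators) ⟩
  ℚᵘ.mkℚᵘ (pos a) 0 ℚᵘ.+ ℚᵘ.mkℚᵘ (pos b) 0  ≡⟨ cong₂ ℚᵘ._+_ (toℚᵘ-ι a) (toℚᵘ-ι b) ⟨
  toℚᵘ (ι a) ℚᵘ.+ toℚᵘ (ι b)                ≈⟨ toℚᵘ-homo-+ (ι a) (ι b) ⟨
  toℚᵘ (ι a + ι b)                          ∎)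
  where
  open ℚᵘP.≃-Reasoning
  numerators : pos (a +ₙ b) ≡ pos a ℤ.* pos 1 ℤ.+ pos b ℤ.* pos 1
  numerators = trans (ℤP.pos-+ a b) (sym (cong₂ ℤ._+_ (ℤP.*-identityʳ (pos a)) (ℤP.*-identityʳ (pos b))))

ι-homo-* : ∀ a b → ι (a *ₙ b) ≡ ι a * ι b
ι-homo-* a b = toℚᵘ-injective (begin
  toℚᵘ (ι (a *ₙ b))                         ≡⟨ toℚᵘ-ι (a *ₙ b) ⟩
  ℚᵘ.mkℚᵘ (pos (a *ₙ b)) 0                  ≈⟨ ℚᵘ.*≡* (cong (ℤ._* pos 1) (ℤP.pos-* a b)) ⟩
  ℚᵘ.mkℚᵘ (pos a) 0 ℚᵘ.* ℚᵘ.mkℚᵘ (pos b) 0  ≡⟨ cong₂ ℚᵘ._*_ (toℚᵘ-ι a) (toℚᵘ-ι b) ⟨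
  toℚᵘ (ι a) ℚᵘ.* toℚᵘ (ι b)                ≈⟨ toℚᵘ-homo-* (ι a) (ι b) ⟨
  toℚᵘ (ι a * ι b)                          ∎)
  where open ℚᵘP.≃-Reasoning

invℕ*ι≡1 : ∀ a → 0 < a → invℕ a * ι a ≡ 1ℚ
invℕ*ι≡1 (suc a) _ = trans (cong₂ _*_ (normalize-coprime (Coprime.1-coprimeTo (suc a))) (ι≡mkℚ (suc a))) (*-inverseˡ q)
  where q = mkℚ (pos (suc a)) 0 (Coprime.sym (Coprime.1-coprimeTo (suc a)))

invℕ-homo-* : ∀ a b → invℕ (a *ₙ b) ≡ invℕ a * invℕ b
invℕ-homo-* zero    b       = sym (*-zeroˡ (invℕ b))
invℕ-homo-* (suc a) zero    = trans (cong invℕ (ℕP.*-zeroʳ a)) (sym (*-zeroʳ (invℕ (suc a))))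
invℕ-homo-* (suc a) (suc b) = begin
  invℕ P                           ≡⟨ *-identityˡ (invℕ P) ⟨
  1ℚ * invℕ P                      ≡⟨ cong (_* invℕ P) inverse ⟨
  ia * ib * ι P * invℕ P           ≡⟨ *-assoc (ia * ib) (ι P) (invℕ P) ⟩
  ia * ib * (ι P * invℕ P)         ≡⟨ cong (ia * ib *_) (trans (*-comm (ι P) (invℕ P)) (invℕ*ι≡1 P (s≤s z≤n))) ⟩
  ia * ib * 1ℚ                     ≡⟨ *-identityʳ (ia * ib) ⟩
  ia * ib                          ∎
  where
  open ≡-Reasoning
  P : ℕ
  P = suc a *ₙ suc b
  ia : ℚ
  ia = invℕ (suc a)
  ib : ℚ
  ib = invℕ (suc b)
  inverse : ia * ib * ι P ≡ 1ℚ
  inverse = begin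
    ia * ib * ι P                      ≡⟨ cong (ia * ib *_) (ι-homo-* (suc a) (suc b)) ⟩
    ia * ib * (ι (suc a) * ι (suc b))  ≡⟨ interchange ia ib (ι (suc a)) (ι (suc b)) ⟩
    ia * ι (suc a) * (ib * ι (suc b))  ≡⟨ cong₂ _*_ (invℕ*ι≡1 (suc a) (s≤s z≤n)) (invℕ*ι≡1 (suc b) (s≤s z≤n)) ⟩
    1ℚ * 1ℚ                            ∎

invℕ*ι-cross : ∀ a c x z → 0 < a → 0 < c → x *ₙ c ≡ z *ₙ a → invℕ a * ι x ≡ invℕ c * ι z
invℕ*ι-cross a c x z 0<a 0<c xc≡za = begin
  invℕ a * ι x                      ≡⟨ widen a c x 0<c ⟩
  invℕ a * invℕ c * ι (x *ₙ c)      ≡⟨ cong₂ (λ u v → u * ι v) (*-comm (invℕ a) (invℕ c)) xc≡za ⟩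
  invℕ c * invℕ a * ι (z *ₙ a)      ≡⟨ widen c a z 0<a ⟨
  invℕ c * ι z                      ∎
  where
  open ≡-Reasoning
  widen : ∀ b d y → 0 < d → invℕ b * ι y ≡ invℕ b * invℕ d * ι (y *ₙ d)
  widen b d y 0<d = begin
    invℕ b * ι y                    ≡⟨ *-identityʳ (invℕ b * ι y) ⟨
    invℕ b * ι y * 1ℚ               ≡⟨ cong (invℕ b * ι y *_) (invℕ*ι≡1 d 0<d) ⟨
    invℕ b * ι y * (invℕ d * ι d)   ≡⟨ interchange (invℕ b) (ι y) (invℕ d) (ι d) ⟩
    invℕ b * invℕ d * (ι y * ι d)   ≡⟨ cong (invℕ b * invℕ d *_) (ι-homo-* y d) ⟨
    invℕ b * invℕ d * ι (y *ₙ d)    ∎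

invℕ-cancel : ∀ x c y D → 0 < c → x * ι c * D * invℕ (c *ₙ y) ≡ x * invℕ y * D
invℕ-cancel x c y D 0<c = begin
  x * ι c * D * invℕ (c *ₙ y)              ≡⟨ cong (x * ι c * D *_) (invℕ-homo-* c y) ⟩
  x * ι c * D * (invℕ c * invℕ y)          ≡⟨ rearrange x (ι c) D (invℕ c) (invℕ y) ⟩
  invℕ c * ι c * (x * invℕ y * D)          ≡⟨ cong (_* (x * invℕ y * D)) (invℕ*ι≡1 c 0<c) ⟩
  1ℚ * (x * invℕ y * D)                    ≡⟨ *-identityˡ (x * invℕ y * D) ⟩
  x * invℕ y * D                           ∎
  where
  open ≡-Reasoning
  rearrange : ∀ x c D c′ y′ → x * c * D * (c′ * y′) ≡ c′ * c * (x * y′ * D)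
  rearrange = solve-∀ ℚ-ring

sumℚ-cong : ∀ m {f g : ℕ → ℚ} → (∀ i → i < m → f i ≡ g i) → sumℚ m f ≡ sumℚ m g
sumℚ-cong zero    _   = refl
sumℚ-cong (suc m) f≡g = cong₂ _+_ (sumℚ-cong m (λ i i<m → f≡g i (ℕP.m<n⇒m<1+n i<m))) (f≡g m ℕP.≤-refl)

sumℚ-zero : ∀ m {f : ℕ → ℚ} → (∀ i → i < m → f i ≡ 0ℚ) → sumℚ m f ≡ 0ℚ
sumℚ-zero zero    _   = refl
sumℚ-zero (suc m) f≡0 = cong₂ _+_ (sumℚ-zero m (λ i i<m → f≡0 i (ℕP.m<n⇒m<1+n i<m))) (f≡0 m ℕP.≤-refl)

sumℚ-+ : ∀ m (f g : ℕ → ℚ) → sumℚ m (λ i → f i + g i) ≡ sumℚ m f + sumℚ m g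
sumℚ-+ zero    f g = refl
sumℚ-+ (suc m) f g = trans (cong (_+ (f m + g m)) (sumℚ-+ m f g)) (+-interchange (sumℚ m f) (sumℚ m g) (f m) (g m))

sumℚ-*ˡ : ∀ m c (f : ℕ → ℚ) → sumℚ m (λ i → c * f i) ≡ c * sumℚ m f
sumℚ-*ˡ zero    c f = sym (*-zeroʳ c)
sumℚ-*ˡ (suc m) c f = trans (cong (_+ c * f m) (sumℚ-*ˡ m c f)) (sym (*-distribˡ-+ c (sumℚ m f) (f m)))

sumℚ-neg : ∀ m (f : ℕ → ℚ) → sumℚ m (λ i → - f i) ≡ - sumℚ m f
sumℚ-neg zero    f = refl
sumℚ-neg (suc m) f = trans (cong (_+ - f m) (sumℚ-neg m f)) (sym (neg-distrib-+ (sumℚ m f) (f m)))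

sumℚ-- : ∀ m (f g : ℕ → ℚ) → sumℚ m (λ i → f i - g i) ≡ sumℚ m f - sumℚ m g
sumℚ-- m f g = trans (sumℚ-+ m f (λ i → - g i)) (cong (sumℚ m f +_) (sumℚ-neg m g))

sumℚ-suc : ∀ m (f : ℕ → ℚ) → sumℚ (suc m) f ≡ f 0 + sumℚ m (λ i → f (suc i))
sumℚ-suc zero    f = trans (+-identityˡ (f 0)) (sym (+-identityʳ (f 0)))
sumℚ-suc (suc m) f = trans (cong (_+ f (suc m)) (sumℚ-suc m f)) (+-assoc (f 0) _ _)

sumℚ-+ₙ : ∀ a b (f : ℕ → ℚ) → sumℚ (a +ₙ b) f ≡ sumℚ a f + sumℚ b (λ i → f (a +ₙ i))
sumℚ-+ₙ a zero    f = trans (cong (λ m → sumℚ m f) (ℕP.+-identityʳ a)) (sym (+-identityʳ _))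
sumℚ-+ₙ a (suc b) f = begin
  sumℚ (a +ₙ suc b) f                                         ≡⟨ cong (λ m → sumℚ m f) (ℕP.+-suc a b) ⟩
  sumℚ (a +ₙ b) f + f (a +ₙ b)                                ≡⟨ cong (_+ f (a +ₙ b)) (sumℚ-+ₙ a b f) ⟩
  sumℚ a f + sumℚ b (λ i → f (a +ₙ i)) + f (a +ₙ b)           ≡⟨ +-assoc (sumℚ a f) _ _ ⟩
  sumℚ a f + sumℚ (suc b) (λ i → f (a +ₙ i))                  ∎
  where open ≡-Reasoning

sumℚ-truncate : ∀ {a b} {f : ℕ → ℚ} → a ≤ b → (∀ i → a ≤ i → f i ≡ 0ℚ) → sumℚ b f ≡ sumℚ a f
sumℚ-truncate {a} {b} {f} a≤b f≡0 = begin
  sumℚ b f                                                    ≡⟨ cong (λ m → sumℚ m f) (ℕP.m+[n∸m]≡n a≤b) ⟨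
  sumℚ (a +ₙ (b ∸ a)) f                                       ≡⟨ sumℚ-+ₙ a (b ∸ a) f ⟩
  sumℚ a f + sumℚ (b ∸ a) (λ i → f (a +ₙ i))
    ≡⟨ cong (sumℚ a f +_) (sumℚ-zero (b ∸ a) (λ i _ → f≡0 (a +ₙ i) (ℕP.m≤m+n a i))) ⟩
  sumℚ a f + 0ℚ                                               ≡⟨ +-identityʳ (sumℚ a f) ⟩
  sumℚ a f                                                    ∎
  where open ≡-Reasoning

sumℚ-comm : ∀ m p (f : ℕ → ℕ → ℚ) → sumℚ m (λ i → sumℚ p (f i)) ≡ sumℚ p (λ j → sumℚ m (λ i → f i j))
sumℚ-comm zero    p f = sym (sumℚ-zero p (λ _ _ → refl))
sumℚ-comm (suc m) p f = trans (cong (_+ sumℚ p (f m)) (sumℚ-comm m p f)) (sym (sumℚ-+ p _ (f m)))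

sumℚ-reverse : ∀ m (f : ℕ → ℚ) → sumℚ m f ≡ sumℚ m (λ i → f (m ∸ suc i))
sumℚ-reverse zero    f = refl
sumℚ-reverse (suc m) f = begin
  sumℚ m f + f m                                              ≡⟨ cong (_+ f m) (sumℚ-reverse m f) ⟩
  sumℚ m (λ i → f (m ∸ suc i)) + f m                          ≡⟨ +-comm _ (f m) ⟩
  f m + sumℚ m (λ i → f (m ∸ suc i))                          ≡⟨ sumℚ-suc m (λ i → f (suc m ∸ suc i)) ⟨
  sumℚ (suc m) (λ i → f (suc m ∸ suc i))                      ∎
  where open ≡-Reasoning

𝟙 : ∀ {p} {P : Set p} → Dec P → ℚ
𝟙 P? = if does P? then 1ℚ else 0ℚ

𝟙-yes : ∀ {p} {P : Set p} (P? : Dec P) → P → 𝟙 P? ≡ 1ℚ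
𝟙-yes P? p rewrite dec-true P? p = refl

𝟙-no : ∀ {p} {P : Set p} (P? : Dec P) → ¬ P → 𝟙 P? ≡ 0ℚ
𝟙-no P? ¬p rewrite dec-false P? ¬p = refl

𝟙<-suc : ∀ s X → 𝟙 (s ℕ.<? suc X) ≡ 𝟙 (s ℕ.<? X) + 𝟙 (s ℕ.≟ X)
𝟙<-suc zero    zero    = refl
𝟙<-suc zero    (suc X) = refl
𝟙<-suc (suc s) zero    = refl
𝟙<-suc (suc s) (suc X) = 𝟙<-suc s X

sumℚ-𝟙≡ : ∀ m x (g : ℕ → ℚ) → x < m → sumℚ m (λ i → g i * 𝟙 (x ℕ.≟ i)) ≡ g x
sumℚ-𝟙≡ m x g x<m = begin
  sumℚ m (λ i → g i * 𝟙 (x ℕ.≟ i))                            ≡⟨ sumℚ-truncate x<m (λ i x<i → off-diagonal i (ℕP.<⇒≢ x<i)) ⟩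
  sumℚ x (λ i → g i * 𝟙 (x ℕ.≟ i)) + g x * 𝟙 (x ℕ.≟ x)
    ≡⟨ cong₂ _+_ (sumℚ-zero x (λ i i<x → off-diagonal i (ℕP.>⇒≢ i<x))) (cong (g x *_) (𝟙-yes (x ℕ.≟ x) refl)) ⟩
  0ℚ + g x * 1ℚ                                               ≡⟨ trans (+-identityˡ _) (*-identityʳ (g x)) ⟩
  g x                                                         ∎
  where
  open ≡-Reasoning
  off-diagonal : ∀ i → x ≢ i → g i * 𝟙 (x ℕ.≟ i) ≡ 0ℚ
  off-diagonal i x≢i = trans (cong (g i *_) (𝟙-no (x ℕ.≟ i) x≢i)) (*-zeroʳ (g i))

sumℚ-𝟙≢ : ∀ m x (g : ℕ → ℚ) → m ≤ x → sumℚ m (λ i → g i * 𝟙 (x ℕ.≟ i)) ≡ 0ℚ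
sumℚ-𝟙≢ m x g m≤x = sumℚ-zero m (λ i i<m →
  trans (cong (g i *_) (𝟙-no (x ℕ.≟ i) (ℕP.>⇒≢ (ℕP.<-≤-trans i<m m≤x)))) (*-zeroʳ (g i)))

sumℚ-𝟙<∸ : ∀ s N (F : ℕ → ℚ) → sumℚ N F ≡ sumℚ (suc N) (λ a → F a * 𝟙 (s ℕ.<? (s +ₙ N) ∸ a))
sumℚ-𝟙<∸ s N F = sym (begin
  sumℚ N (λ a → F a * 𝟙 (s ℕ.<? M ∸ a)) + F N * 𝟙 (s ℕ.<? M ∸ N)  ≡⟨ cong₂ _+_ (sumℚ-cong N below-N) last ⟩
  sumℚ N F + 0ℚ                                                   ≡⟨ +-identityʳ (sumℚ N F) ⟩
  sumℚ N F                                                        ∎)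
  where
  open ≡-Reasoning
  M : ℕ
  M = s +ₙ N
  below-N : ∀ a → a < N → F a * 𝟙 (s ℕ.<? M ∸ a) ≡ F a
  below-N a a<N = trans (cong (F a *_) (𝟙-yes (s ℕ.<? M ∸ a) s<M∸a)) (*-identityʳ (F a))
    where
    s<M∸a : s < M ∸ a
    s<M∸a = subst (s <_) (sym (ℕP.+-∸-assoc s (ℕP.<⇒≤ a<N))) (ℕP.m<m+n s (ℕP.m<n⇒0<n∸m a<N))
  last : F N * 𝟙 (s ℕ.<? M ∸ N) ≡ 0ℚ
  last = begin
    F N * 𝟙 (s ℕ.<? M ∸ N)   ≡⟨ cong (λ x → F N * 𝟙 (s ℕ.<? x)) (ℕP.m+n∸n≡m s N) ⟩
    F N * 𝟙 (s ℕ.<? s)       ≡⟨ cong (F N *_) (𝟙-no (s ℕ.<? s) (ℕP.n≮n s)) ⟩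
    F N * 0ℚ                 ≡⟨ *-zeroʳ (F N) ⟩
    0ℚ                       ∎

k≤n⇒0<nCk : ∀ {n k} → k ≤ n → 0 < n C k
k≤n⇒0<nCk {n}     {zero}  _         = s≤s z≤n
k≤n⇒0<nCk {suc n} {suc k} (s≤s k≤n) =
  subst (0 <_) (ℕC.nCk+nC[k+1]≡[n+1]C[k+1] n k) (ℕP.<-≤-trans (k≤n⇒0<nCk k≤n) (ℕP.m≤m+n _ _))

[1+k]*[1+n]C[1+k]≡[1+n]*nCk : ∀ n k → suc k *ₙ (suc n C suc k) ≡ suc n *ₙ (n C k)
[1+k]*[1+n]C[1+k]≡[1+n]*nCk n zero =
  trans (ℕP.*-identityˡ _) (trans (ℕC.nC1≡n (suc n)) (sym (ℕP.*-identityʳ (suc n))))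
[1+k]*[1+n]C[1+k]≡[1+n]*nCk zero (suc k) =
  trans (cong (suc (suc k) *ₙ_) (ℕC.k>n⇒nCk≡0 {1} {suc (suc k)} (s≤s (s≤s z≤n)))) (ℕP.*-zeroʳ (suc (suc k)))
[1+k]*[1+n]C[1+k]≡[1+n]*nCk (suc n) (suc k) = begin
  suc (suc k) *ₙ (suc (suc n) C suc (suc k))             ≡⟨ cong (suc (suc k) *ₙ_) (sym (ℕC.nCk+nC[k+1]≡[n+1]C[k+1] (suc n) (suc k))) ⟩
  suc (suc k) *ₙ (X +ₙ Y)                                ≡⟨ expand (suc k) X Y ⟩
  suc k *ₙ X +ₙ X +ₙ suc (suc k) *ₙ Y
    ≡⟨ cong₂ (λ u v → u +ₙ X +ₙ v) ([1+k]*[1+n]C[1+k]≡[1+n]*nCk n k) ([1+k]*[1+n]C[1+k]≡[1+n]*nCk n (suc k)) ⟩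
  suc n *ₙ (n C k) +ₙ X +ₙ suc n *ₙ (n C suc k)          ≡⟨ collect (suc n) (n C k) X (n C suc k) ⟩
  suc n *ₙ (n C k +ₙ n C suc k) +ₙ X                     ≡⟨ cong (λ u → suc n *ₙ u +ₙ X) (ℕC.nCk+nC[k+1]≡[n+1]C[k+1] n k) ⟩
  suc n *ₙ X +ₙ X                                        ≡⟨ ℕP.+-comm (suc n *ₙ X) X ⟩
  suc (suc n) *ₙ X                                       ∎
  where
  open ≡-Reasoning
  X : ℕ
  X = suc n C suc k
  Y : ℕ
  Y = suc n C suc (suc k)
  expand : ∀ a x y → suc a *ₙ (x +ₙ y) ≡ a *ₙ x +ₙ x +ₙ suc a *ₙ y
  expand = solve-∀ ℕ-ring
  collect : ∀ a p x q → a *ₙ p +ₙ x +ₙ a *ₙ q ≡ a *ₙ (p +ₙ q) +ₙ x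
  collect = solve-∀ ℕ-ring

trinomial-revision : ∀ n a b → (n C a) *ₙ ((n ∸ a) C b) ≡ (n C (a +ₙ b)) *ₙ ((a +ₙ b) C a)
trinomial-revision n       zero    b = trans (ℕP.*-identityˡ _) (sym (ℕP.*-identityʳ _))
trinomial-revision zero    (suc a) b = refl
trinomial-revision (suc n) (suc a) b = ℕP.*-cancelˡ-≡ _ _ (suc a) (begin
  suc a *ₙ ((suc n C suc a) *ₙ ((n ∸ a) C b))            ≡⟨ ℕP.*-assoc (suc a) (suc n C suc a) ((n ∸ a) C b) ⟨
  suc a *ₙ (suc n C suc a) *ₙ ((n ∸ a) C b)              ≡⟨ cong (_*ₙ ((n ∸ a) C b)) ([1+k]*[1+n]C[1+k]≡[1+n]*nCk n a) ⟩
  suc n *ₙ (n C a) *ₙ ((n ∸ a) C b)                      ≡⟨ ℕP.*-assoc (suc n) (n C a) ((n ∸ a) C b) ⟩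
  suc n *ₙ ((n C a) *ₙ ((n ∸ a) C b))                    ≡⟨ cong (suc n *ₙ_) (trinomial-revision n a b) ⟩
  suc n *ₙ ((n C c) *ₙ (c C a))                          ≡⟨ ℕP.*-assoc (suc n) (n C c) (c C a) ⟨
  suc n *ₙ (n C c) *ₙ (c C a)                            ≡⟨ cong (_*ₙ (c C a)) ([1+k]*[1+n]C[1+k]≡[1+n]*nCk n c) ⟨
  suc c *ₙ (suc n C suc c) *ₙ (c C a)                    ≡⟨ x∙y∙z≡y∙x∙z (suc c) (suc n C suc c) (c C a) ⟩
  (suc n C suc c) *ₙ (suc c *ₙ (c C a))                  ≡⟨ cong ((suc n C suc c) *ₙ_) ([1+k]*[1+n]C[1+k]≡[1+n]*nCk c a) ⟨
  (suc n C suc c) *ₙ (suc a *ₙ (suc c C suc a))          ≡⟨ x∙[y∙z]≡y∙[x∙z] (suc n C suc c) (suc a) (suc c C suc a) ⟩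
  suc a *ₙ ((suc n C suc c) *ₙ (suc c C suc a))          ∎)
  where
  open ≡-Reasoning
  c : ℕ
  c = a +ₙ b
  x∙y∙z≡y∙x∙z : ∀ x y z → x *ₙ y *ₙ z ≡ y *ₙ (x *ₙ z)
  x∙y∙z≡y∙x∙z = solve-∀ ℕ-ring
  x∙[y∙z]≡y∙[x∙z] : ∀ x y z → x *ₙ (y *ₙ z) ≡ y *ₙ (x *ₙ z)
  x∙[y∙z]≡y∙[x∙z] = solve-∀ ℕ-ring

[a+b]Ca≡[b+a]Cb : ∀ a b → (a +ₙ b) C a ≡ (b +ₙ a) C b
[a+b]Ca≡[b+a]Cb a b = begin
  (a +ₙ b) C a                  ≡⟨ ℕC.nCk≡nC[n∸k] (ℕP.m≤m+n a b) ⟩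
  (a +ₙ b) C ((a +ₙ b) ∸ a)     ≡⟨ cong₂ _C_ (ℕP.+-comm a b) (ℕP.m+n∸m≡n a b) ⟩
  (b +ₙ a) C b                  ∎
  where open ≡-Reasoning

trinomial-revision-comm : ∀ n a b → (n C a) *ₙ ((n ∸ a) C b) ≡ (n C b) *ₙ ((n ∸ b) C a)
trinomial-revision-comm n a b = begin
  (n C a) *ₙ ((n ∸ a) C b)               ≡⟨ trinomial-revision n a b ⟩
  (n C (a +ₙ b)) *ₙ ((a +ₙ b) C a)       ≡⟨ cong₂ (λ c d → (n C c) *ₙ d) (ℕP.+-comm a b) ([a+b]Ca≡[b+a]Cb a b) ⟩
  (n C (b +ₙ a)) *ₙ ((b +ₙ a) C b)       ≡⟨ trinomial-revision n b a ⟨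
  (n C b) *ₙ ((n ∸ b) C a)               ∎
  where open ≡-Reasoning

subset-of-subset : ∀ n k j → j ≤ k → (n C k) *ₙ (k C j) ≡ (n C j) *ₙ ((n ∸ j) C (k ∸ j))
subset-of-subset n k j j≤k = sym (begin
  (n C j) *ₙ ((n ∸ j) C (k ∸ j))              ≡⟨ trinomial-revision n j (k ∸ j) ⟩
  (n C (j +ₙ (k ∸ j))) *ₙ ((j +ₙ (k ∸ j)) C j) ≡⟨ cong (λ c → (n C c) *ₙ (c C j)) (ℕP.m+[n∸m]≡n j≤k) ⟩
  (n C k) *ₙ (k C j)                           ∎)
  where open ≡-Reasoning

[n+j]∸l<n : ∀ n {j l} → 0 < n → j < l → (n +ₙ j) ∸ l < n
[n+j]∸l<n (suc n) {zero}  {suc l} _   _         = s≤s (subst (λ x → x ∸ l ≤ n) (sym (ℕP.+-identityʳ n)) (ℕP.m∸n≤m n l))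
[n+j]∸l<n n       {suc j} {suc l} 0<n (s≤s j<l) = subst (λ x → x ∸ suc l < n) (sym (ℕP.+-suc n j)) ([n+j]∸l<n n 0<n j<l)

ι-nCk≡0 : ∀ {n k} → n < k → ι (n C k) ≡ 0ℚ
ι-nCk≡0 n<k = cong ι (ℕC.k>n⇒nCk≡0 n<k)

ι-pascal : ∀ n k → ι (suc n C suc k) ≡ ι (n C k) + ι (n C suc k)
ι-pascal n k = trans (cong ι (sym (ℕC.nCk+nC[k+1]≡[n+1]C[k+1] n k))) (ι-homo-+ (n C k) (n C suc k))

ι-trinomial-revision-comm : ∀ n a b → ι (n C a) * ι ((n ∸ a) C b) ≡ ι (n C b) * ι ((n ∸ b) C a)
ι-trinomial-revision-comm n a b = begin
  ι (n C a) * ι ((n ∸ a) C b)       ≡⟨ ι-homo-* (n C a) ((n ∸ a) C b) ⟨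
  ι ((n C a) *ₙ ((n ∸ a) C b))      ≡⟨ cong ι (trinomial-revision-comm n a b) ⟩
  ι ((n C b) *ₙ ((n ∸ b) C a))      ≡⟨ ι-homo-* (n C b) ((n ∸ b) C a) ⟩
  ι (n C b) * ι ((n ∸ b) C a)       ∎
  where open ≡-Reasoning

sumℚ-pascal : ∀ L X (g : ℕ → ℚ) →
  sumℚ (suc L) (λ m → g m * ι (suc X C m)) ≡ sumℚ (suc L) (λ m → g m * ι (X C m)) + sumℚ L (λ m → g (suc m) * ι (X C m))
sumℚ-pascal L X g = begin
  sumℚ (suc L) (λ m → g m * ι (suc X C m))                       ≡⟨ sumℚ-suc L _ ⟩
  g 0 * 1ℚ + sumℚ L (λ m → g (suc m) * ι (suc X C suc m))        ≡⟨ cong (g 0 * 1ℚ +_) (sumℚ-cong L (λ m _ → pascal m)) ⟩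
  g 0 * 1ℚ + sumℚ L (λ m → g (suc m) * ι (X C m) + g (suc m) * ι (X C suc m))
                                                                 ≡⟨ cong (g 0 * 1ℚ +_) (sumℚ-+ L _ _) ⟩
  g 0 * 1ℚ + (Σlow + Σhigh)                                      ≡⟨ cong (g 0 * 1ℚ +_) (+-comm Σlow Σhigh) ⟩
  g 0 * 1ℚ + (Σhigh + Σlow)                                      ≡⟨ +-assoc (g 0 * 1ℚ) Σhigh Σlow ⟨
  g 0 * 1ℚ + Σhigh + Σlow                                        ≡⟨ cong (_+ Σlow) (sumℚ-suc L _) ⟨
  sumℚ (suc L) (λ m → g m * ι (X C m)) + Σlow                    ∎
  where
  open ≡-Reasoning
  Σlow : ℚ
  Σlow = sumℚ L (λ m → g (suc m) * ι (X C m))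
  Σhigh : ℚ
  Σhigh = sumℚ L (λ m → g (suc m) * ι (X C suc m))
  pascal : ∀ m → g (suc m) * ι (suc X C suc m) ≡ g (suc m) * ι (X C m) + g (suc m) * ι (X C suc m)
  pascal m = trans (cong (g (suc m) *_) (ι-pascal X m)) (*-distribˡ-+ (g (suc m)) _ _)

vandermonde : ∀ A B K → sumℚ (suc K) (λ a → ι (B C (K ∸ a)) * ι (A C a)) ≡ ι ((A +ₙ B) C K)
vandermonde zero    B K = begin
  sumℚ (suc K) (λ a → ι (B C (K ∸ a)) * ι (0 C a))           ≡⟨ sumℚ-suc K _ ⟩
  ι (B C K) * 1ℚ + sumℚ K (λ a → ι (B C (K ∸ suc a)) * 0ℚ)
    ≡⟨ cong₂ _+_ (*-identityʳ (ι (B C K))) (sumℚ-zero K (λ a _ → *-zeroʳ (ι (B C (K ∸ suc a))))) ⟩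
  ι (B C K) + 0ℚ                                             ≡⟨ +-identityʳ _ ⟩
  ι (B C K)                                                  ∎
  where open ≡-Reasoning
vandermonde (suc A) B zero    = refl
vandermonde (suc A) B (suc K) = begin
  sumℚ (suc (suc K)) (λ a → ι (B C (suc K ∸ a)) * ι (suc A C a))  ≡⟨ sumℚ-pascal (suc K) A (λ a → ι (B C (suc K ∸ a))) ⟩
  Σ₁ + sumℚ (suc K) (λ a → ι (B C (K ∸ a)) * ι (A C a))           ≡⟨ cong₂ _+_ (vandermonde A B (suc K)) (vandermonde A B K) ⟩
  ι ((A +ₙ B) C suc K) + ι ((A +ₙ B) C K)                         ≡⟨ +-comm (ι ((A +ₙ B) C suc K)) _ ⟩
  ι ((A +ₙ B) C K) + ι ((A +ₙ B) C suc K)                         ≡⟨ ι-pascal (A +ₙ B) K ⟨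
  ι (suc (A +ₙ B) C suc K)                                        ∎
  where
  open ≡-Reasoning
  Σ₁ : ℚ
  Σ₁ = sumℚ (suc (suc K)) (λ a → ι (B C (suc K ∸ a)) * ι (A C a))

-- Finite differences

-- The r-th forward difference of g at 0.  The inner sum of a_r is Δ r applied to
-- j ↦ binom(n - min(k - j, t), n - k).
Δ : ℕ → (ℕ → ℚ) → ℚ
Δ r g = sumℚ (suc r) (λ j → neg1^ (r ∸ j) * ι (r C j) * g j)

Δ-cong : ∀ r {g h : ℕ → ℚ} → (∀ j → j ≤ r → g j ≡ h j) → Δ r g ≡ Δ r h
Δ-cong r g≡h = sumℚ-cong (suc r) (λ j j<1+r → cong (neg1^ (r ∸ j) * ι (r C j) *_) (g≡h j (ℕP.≤-pred j<1+r)))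

Δ-zero : ∀ r {g : ℕ → ℚ} → (∀ j → j ≤ r → g j ≡ 0ℚ) → Δ r g ≡ 0ℚ
Δ-zero r g≡0 = sumℚ-zero (suc r) (λ j j<1+r →
  trans (cong (neg1^ (r ∸ j) * ι (r C j) *_) (g≡0 j (ℕP.≤-pred j<1+r))) (*-zeroʳ (neg1^ (r ∸ j) * ι (r C j))))

Δ-+ : ∀ r (g h : ℕ → ℚ) → Δ r (λ j → g j + h j) ≡ Δ r g + Δ r h
Δ-+ r g h = trans (sumℚ-cong (suc r) (λ j _ → *-distribˡ-+ (neg1^ (r ∸ j) * ι (r C j)) (g j) (h j))) (sumℚ-+ (suc r) _ _)

Δ-*ˡ : ∀ r c (g : ℕ → ℚ) → Δ r (λ j → c * g j) ≡ c * Δ r g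
Δ-*ˡ r c g = trans (sumℚ-cong (suc r) (λ j _ → x∙[y∙z]≡y∙[x∙z] (neg1^ (r ∸ j) * ι (r C j)) c (g j))) (sumℚ-*ˡ (suc r) c _)
  where
  x∙[y∙z]≡y∙[x∙z] : ∀ x y z → x * (y * z) ≡ y * (x * z)
  x∙[y∙z]≡y∙[x∙z] = solve-∀ ℚ-ring

Δ-sumℚ : ∀ r L (g : ℕ → ℕ → ℚ) → Δ r (λ j → sumℚ L (λ l → g l j)) ≡ sumℚ L (λ l → Δ r (g l))
Δ-sumℚ r L g = trans (sumℚ-cong (suc r) (λ j _ → sym (sumℚ-*ˡ L (neg1^ (r ∸ j) * ι (r C j)) (λ l → g l j))))
                     (sumℚ-comm (suc r) L _)

Δ-suc : ∀ r g → Δ (suc r) g ≡ Δ r (λ j → g (suc j) - g j)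
Δ-suc r g = begin
  Δ (suc r) g                                                     ≡⟨ sumℚ-cong (suc (suc r)) (λ j _ → xy∙z≡xz∙y (neg1^ (suc r ∸ j)) (ι (suc r C j)) (g j)) ⟩
  sumℚ (suc (suc r)) (λ j → h j * ι (suc r C j))                  ≡⟨ sumℚ-pascal (suc r) r h ⟩
  Σ₀ + h (suc r) * ι (r C suc r) + Σ₊                             ≡⟨ cong (λ x → Σ₀ + h (suc r) * x + Σ₊) (ι-nCk≡0 (ℕP.n<1+n r)) ⟩
  Σ₀ + h (suc r) * 0ℚ + Σ₊                                        ≡⟨ cong (λ x → Σ₀ + x + Σ₊) (*-zeroʳ (h (suc r))) ⟩
  Σ₀ + 0ℚ + Σ₊                                                    ≡⟨ cong (_+ Σ₊) (+-identityʳ Σ₀) ⟩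
  Σ₀ + Σ₊                                                         ≡⟨ sumℚ-+ (suc r) (λ j → h j * ι (r C j)) (λ j → h (suc j) * ι (r C j)) ⟨
  sumℚ (suc r) (λ j → h j * ι (r C j) + h (suc j) * ι (r C j))    ≡⟨ sumℚ-cong (suc r) (λ j j<1+r → combine j (ℕP.≤-pred j<1+r)) ⟩
  Δ r (λ j → g (suc j) - g j)                                     ∎
  where
  open ≡-Reasoning
  h : ℕ → ℚ
  h j = neg1^ (suc r ∸ j) * g j
  Σ₀ : ℚ
  Σ₀ = sumℚ (suc r) (λ j → h j * ι (r C j))
  Σ₊ : ℚ
  Σ₊ = sumℚ (suc r) (λ j → h (suc j) * ι (r C j))
  xy∙z≡xz∙y : ∀ x y z → x * y * z ≡ x * z * y
  xy∙z≡xz∙y = solve-∀ ℚ-ring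
  alternate : ∀ σ c x y → (- σ * x) * c + (σ * y) * c ≡ σ * c * (y - x)
  alternate = solve-∀ ℚ-ring
  combine : ∀ j → j ≤ r → h j * ι (r C j) + h (suc j) * ι (r C j) ≡ neg1^ (r ∸ j) * ι (r C j) * (g (suc j) - g j)
  combine j j≤r rewrite ℕP.+-∸-assoc 1 j≤r = alternate (neg1^ (r ∸ j)) (ι (r C j)) (g j) (g (suc j))

Δ-const : ∀ r c → Δ (suc r) (λ _ → c) ≡ 0ℚ
Δ-const r c = trans (Δ-suc r (λ _ → c)) (Δ-zero r (λ _ _ → +-inverseʳ c))

Δ-binomial : ∀ r d a → Δ r (λ j → ι ((a +ₙ j) C (r +ₙ d))) ≡ ι (a C d)
Δ-binomial zero    d a = begin
  0ℚ + 1ℚ * ι ((a +ₙ 0) C d)   ≡⟨ trans (+-identityˡ (1ℚ * ι ((a +ₙ 0) C d))) (*-identityˡ (ι ((a +ₙ 0) C d))) ⟩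
  ι ((a +ₙ 0) C d)             ≡⟨ cong (λ x → ι (x C d)) (ℕP.+-identityʳ a) ⟩
  ι (a C d)                    ∎
  where open ≡-Reasoning
Δ-binomial (suc r) d a = begin
  Δ (suc r) (λ j → ι ((a +ₙ j) C c))                            ≡⟨ Δ-suc r (λ j → ι ((a +ₙ j) C c)) ⟩
  Δ r (λ j → ι ((a +ₙ suc j) C c) - ι ((a +ₙ j) C c))           ≡⟨ Δ-cong r (λ j _ → pascal j) ⟩
  Δ r (λ j → ι ((a +ₙ j) C (r +ₙ d)))                           ≡⟨ Δ-binomial r d a ⟩
  ι (a C d)                                                     ∎
  where
  open ≡-Reasoning
  c : ℕ
  c = suc (r +ₙ d)
  x+y-y≡x : ∀ x y → x + y - y ≡ x
  x+y-y≡x = solve-∀ ℚ-ring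
  pascal : ∀ j → ι ((a +ₙ suc j) C c) - ι ((a +ₙ j) C c) ≡ ι ((a +ₙ j) C (r +ₙ d))
  pascal j = begin
    ι ((a +ₙ suc j) C c) - ι ((a +ₙ j) C c)                        ≡⟨ cong (λ x → ι (x C c) - ι ((a +ₙ j) C c)) (ℕP.+-suc a j) ⟩
    ι (suc (a +ₙ j) C c) - ι ((a +ₙ j) C c)                        ≡⟨ cong (_- ι ((a +ₙ j) C c)) (ι-pascal (a +ₙ j) (r +ₙ d)) ⟩
    ι ((a +ₙ j) C (r +ₙ d)) + ι ((a +ₙ j) C c) - ι ((a +ₙ j) C c)  ≡⟨ x+y-y≡x (ι ((a +ₙ j) C (r +ₙ d))) (ι ((a +ₙ j) C c)) ⟩
    ι ((a +ₙ j) C (r +ₙ d))                                        ∎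

-- Inverting the Pascal matrix

pascal⁻¹ : ℕ → ℕ → ℚ
pascal⁻¹ s m = neg1^ (m ∸ s) * ι (m C s)

pascal⁻¹-zero-suc : ∀ m → pascal⁻¹ 0 (suc m) ≡ - pascal⁻¹ 0 m
pascal⁻¹-zero-suc m = sym (neg-distribˡ-* (neg1^ m) 1ℚ)

pascal⁻¹-suc-suc : ∀ s m → pascal⁻¹ (suc s) (suc m) ≡ pascal⁻¹ s m - pascal⁻¹ (suc s) m
pascal⁻¹-suc-suc s m = begin
  neg1^ (m ∸ s) * ι (suc m C suc s)                       ≡⟨ cong (neg1^ (m ∸ s) *_) (ι-pascal m s) ⟩
  neg1^ (m ∸ s) * (ι (m C s) + ι (m C suc s))             ≡⟨ *-distribˡ-+ (neg1^ (m ∸ s)) (ι (m C s)) (ι (m C suc s)) ⟩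
  pascal⁻¹ s m + neg1^ (m ∸ s) * ι (m C suc s)            ≡⟨ cong (pascal⁻¹ s m +_) (sign-shift (ℕP.≤-<-connex (suc s) m)) ⟩
  pascal⁻¹ s m - pascal⁻¹ (suc s) m                       ∎
  where
  open ≡-Reasoning
  sign-shift : suc s ≤ m ⊎ m < suc s → neg1^ (m ∸ s) * ι (m C suc s) ≡ - pascal⁻¹ (suc s) m
  sign-shift (inj₁ s<m) rewrite ℕP.+-∸-assoc 1 s<m = sym (neg-distribˡ-* (neg1^ (m ∸ suc s)) (ι (m C suc s)))
  sign-shift (inj₂ m<1+s) rewrite ι-nCk≡0 m<1+s | *-zeroʳ (neg1^ (m ∸ s)) | *-zeroʳ (neg1^ (m ∸ suc s)) = refl

pascal⁻¹-inverse : ∀ s X L → X < L → sumℚ L (λ m → pascal⁻¹ s m * ι (X C m)) ≡ 𝟙 (s ℕ.≟ X)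
pascal⁻¹-inverse s zero (suc L) _ = begin
  sumℚ (suc L) (λ m → pascal⁻¹ s m * ι (0 C m))                  ≡⟨ sumℚ-suc L (λ m → pascal⁻¹ s m * ι (0 C m)) ⟩
  pascal⁻¹ s 0 * 1ℚ + sumℚ L (λ m → pascal⁻¹ s (suc m) * 0ℚ)
    ≡⟨ cong₂ _+_ (*-identityʳ (pascal⁻¹ s 0)) (sumℚ-zero L (λ m _ → *-zeroʳ (pascal⁻¹ s (suc m)))) ⟩
  pascal⁻¹ s 0 + 0ℚ                                              ≡⟨ +-identityʳ (pascal⁻¹ s 0) ⟩
  pascal⁻¹ s 0                                                   ≡⟨ at-zero s ⟩
  𝟙 (s ℕ.≟ 0)                                                    ∎
  where
  open ≡-Reasoning
  at-zero : ∀ s → pascal⁻¹ s 0 ≡ 𝟙 (s ℕ.≟ 0)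
  at-zero zero    = refl
  at-zero (suc s) = refl
pascal⁻¹-inverse s (suc X) (suc L) (s≤s X<L) = begin
  sumℚ (suc L) (λ m → pascal⁻¹ s m * ι (suc X C m))              ≡⟨ sumℚ-pascal L X (pascal⁻¹ s) ⟩
  sumℚ (suc L) (λ m → pascal⁻¹ s m * ι (X C m)) + sumℚ L (λ m → pascal⁻¹ s (suc m) * ι (X C m))
                                                                 ≡⟨ cong₂ _+_ (pascal⁻¹-inverse s X (suc L) (ℕP.m<n⇒m<1+n X<L)) (shifted s) ⟩
  𝟙 (s ℕ.≟ X) + (𝟙 (s ℕ.≟ suc X) - 𝟙 (s ℕ.≟ X))                  ≡⟨ x+[y-x]≡y (𝟙 (s ℕ.≟ X)) (𝟙 (s ℕ.≟ suc X)) ⟩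
  𝟙 (s ℕ.≟ suc X)                                                ∎
  where
  open ≡-Reasoning
  x+[y-x]≡y : ∀ x y → x + (y - x) ≡ y
  x+[y-x]≡y = solve-∀ ℚ-ring
  shifted : ∀ s → sumℚ L (λ m → pascal⁻¹ s (suc m) * ι (X C m)) ≡ 𝟙 (s ℕ.≟ suc X) - 𝟙 (s ℕ.≟ X)
  shifted zero = begin
    sumℚ L (λ m → pascal⁻¹ 0 (suc m) * ι (X C m))
      ≡⟨ sumℚ-cong L (λ m _ → trans (cong (_* ι (X C m)) (pascal⁻¹-zero-suc m)) (sym (neg-distribˡ-* (pascal⁻¹ 0 m) (ι (X C m))))) ⟩
    sumℚ L (λ m → - (pascal⁻¹ 0 m * ι (X C m)))                  ≡⟨ sumℚ-neg L (λ m → pascal⁻¹ 0 m * ι (X C m)) ⟩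
    - sumℚ L (λ m → pascal⁻¹ 0 m * ι (X C m))                    ≡⟨ cong -_ (pascal⁻¹-inverse 0 X L X<L) ⟩
    - 𝟙 (0 ℕ.≟ X)                                                ≡⟨ +-identityˡ (- 𝟙 (0 ℕ.≟ X)) ⟨
    0ℚ - 𝟙 (0 ℕ.≟ X)                                             ∎
  shifted (suc s) = begin
    sumℚ L (λ m → pascal⁻¹ (suc s) (suc m) * ι (X C m))
      ≡⟨ sumℚ-cong L (λ m _ → trans (cong (_* ι (X C m)) (pascal⁻¹-suc-suc s m)) (*-distribʳ-- (ι (X C m)) (pascal⁻¹ s m) (pascal⁻¹ (suc s) m))) ⟩
    sumℚ L (λ m → pascal⁻¹ s m * ι (X C m) - pascal⁻¹ (suc s) m * ι (X C m))
                                                                 ≡⟨ sumℚ-- L (λ m → pascal⁻¹ s m * ι (X C m)) (λ m → pascal⁻¹ (suc s) m * ι (X C m)) ⟩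
    sumℚ L (λ m → pascal⁻¹ s m * ι (X C m)) - sumℚ L (λ m → pascal⁻¹ (suc s) m * ι (X C m))
                                                                 ≡⟨ cong₂ _-_ (pascal⁻¹-inverse s X L X<L) (pascal⁻¹-inverse (suc s) X L X<L) ⟩
    𝟙 (s ℕ.≟ X) - 𝟙 (suc s ℕ.≟ X)                                ∎
    where
    *-distribʳ-- : ∀ x y z → (y - z) * x ≡ y * x - z * x
    *-distribʳ-- = solve-∀ ℚ-ring

-- ω s (k - i) is the coefficient (-1)^(t-1-i) binom(k-1-i, k-t) of D_{k-i} in Ω, where s = k - t.
ω : ℕ → ℕ → ℚ
ω s zero    = 0ℚ
ω s (suc l) = pascal⁻¹ s l

ω-vanish : ∀ {s l} → l ≤ s → ω s l ≡ 0ℚ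
ω-vanish {s} {zero}  _   = refl
ω-vanish {s} {suc l} l<s = trans (cong (neg1^ (l ∸ s) *_) (ι-nCk≡0 l<s)) (*-zeroʳ (neg1^ (l ∸ s)))

ω-binomial : ∀ s X L → X < L → sumℚ L (λ l → ω s l * ι (X C l)) ≡ 𝟙 (s ℕ.<? X)
ω-binomial s zero (suc L) _ =
  trans (sumℚ-suc L _) (trans (+-identityˡ _) (sumℚ-zero L (λ l _ → *-zeroʳ (ω s (suc l)))))
ω-binomial s (suc X) (suc L) (s≤s X<L) = begin
  sumℚ (suc L) (λ l → ω s l * ι (suc X C l))                    ≡⟨ sumℚ-pascal L X (ω s) ⟩
  sumℚ (suc L) (λ l → ω s l * ι (X C l)) + sumℚ L (λ l → pascal⁻¹ s l * ι (X C l))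
                                                                ≡⟨ cong₂ _+_ (ω-binomial s X (suc L) (ℕP.m<n⇒m<1+n X<L)) (pascal⁻¹-inverse s X L X<L) ⟩
  𝟙 (s ℕ.<? X) + 𝟙 (s ℕ.≟ X)                                    ≡⟨ 𝟙<-suc s X ⟨
  𝟙 (s ℕ.<? suc X)                                              ∎
  where open ≡-Reasoning

-- The difference of the capped binomial

-- Vandermonde, then the bracket [s < s + N - a] is expanded by ω-binomial and the two sums are
-- exchanged by trinomial revision.
binomial-expansion : ∀ s N p → let M = s +ₙ N in
  ι ((M +ₙ p) C N) ≡ ι (M C N) + sumℚ (suc M) (λ l → ω s l * ι (M C l) * ι (((M ∸ l) +ₙ p) C N))
binomial-expansion s N p = begin
  ι ((M +ₙ p) C N)                                                           ≡⟨ vandermonde M p N ⟨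
  sumℚ N F + F N                                                             ≡⟨ cong₂ _+_ (sumℚ-𝟙<∸ s N F) last ⟩
  sumℚ (suc N) (λ a → F a * 𝟙 (s ℕ.<? M ∸ a)) + ι (M C N)                    ≡⟨ cong (_+ ι (M C N)) expand ⟩
  sumℚ (suc M) (λ l → ω s l * ι (M C l) * ι (((M ∸ l) +ₙ p) C N)) + ι (M C N) ≡⟨ +-comm _ (ι (M C N)) ⟩
  ι (M C N) + sumℚ (suc M) (λ l → ω s l * ι (M C l) * ι (((M ∸ l) +ₙ p) C N)) ∎
  where
  open ≡-Reasoning
  M : ℕ
  M = s +ₙ N
  F : ℕ → ℚ
  F a = ι (p C (N ∸ a)) * ι (M C a)
  last : F N ≡ ι (M C N)
  last = trans (cong (λ x → ι (p C x) * ι (M C N)) (ℕP.n∸n≡0 N)) (*-identityˡ (ι (M C N)))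
  H : ℕ → ℕ → ℚ
  H l a = ι (p C (N ∸ a)) * ι ((M ∸ l) C a)
  regroup : ∀ a l → F a * (ω s l * ι ((M ∸ a) C l)) ≡ ω s l * ι (M C l) * H l a
  regroup a l = begin
    ι (p C (N ∸ a)) * ι (M C a) * (ω s l * ι ((M ∸ a) C l))      ≡⟨ xy∙zu≡z[x[yu]] (ι (p C (N ∸ a))) (ι (M C a)) (ω s l) (ι ((M ∸ a) C l)) ⟩
    ω s l * (ι (p C (N ∸ a)) * (ι (M C a) * ι ((M ∸ a) C l)))    ≡⟨ cong (λ x → ω s l * (ι (p C (N ∸ a)) * x)) (ι-trinomial-revision-comm M a l) ⟩
    ω s l * (ι (p C (N ∸ a)) * (ι (M C l) * ι ((M ∸ l) C a)))    ≡⟨ x[y[zu]]≡xz∙yu (ω s l) (ι (p C (N ∸ a))) (ι (M C l)) (ι ((M ∸ l) C a)) ⟩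
    ω s l * ι (M C l) * (ι (p C (N ∸ a)) * ι ((M ∸ l) C a))      ∎
    where
    xy∙zu≡z[x[yu]] : ∀ x y z u → x * y * (z * u) ≡ z * (x * (y * u))
    xy∙zu≡z[x[yu]] = solve-∀ ℚ-ring
    x[y[zu]]≡xz∙yu : ∀ x y z u → x * (y * (z * u)) ≡ x * z * (y * u)
    x[y[zu]]≡xz∙yu = solve-∀ ℚ-ring
  expand : sumℚ (suc N) (λ a → F a * 𝟙 (s ℕ.<? M ∸ a)) ≡ sumℚ (suc M) (λ l → ω s l * ι (M C l) * ι (((M ∸ l) +ₙ p) C N))
  expand = begin
    sumℚ (suc N) (λ a → F a * 𝟙 (s ℕ.<? M ∸ a))
      ≡⟨ sumℚ-cong (suc N) (λ a _ → cong (F a *_) (ω-binomial s (M ∸ a) (suc M) (s≤s (ℕP.m∸n≤m M a)))) ⟨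
    sumℚ (suc N) (λ a → F a * sumℚ (suc M) (λ l → ω s l * ι ((M ∸ a) C l)))
      ≡⟨ sumℚ-cong (suc N) (λ a _ → sumℚ-*ˡ (suc M) (F a) (λ l → ω s l * ι ((M ∸ a) C l))) ⟨
    sumℚ (suc N) (λ a → sumℚ (suc M) (λ l → F a * (ω s l * ι ((M ∸ a) C l))))
      ≡⟨ sumℚ-comm (suc N) (suc M) (λ a l → F a * (ω s l * ι ((M ∸ a) C l))) ⟩
    sumℚ (suc M) (λ l → sumℚ (suc N) (λ a → F a * (ω s l * ι ((M ∸ a) C l))))
      ≡⟨ sumℚ-cong (suc M) (λ l _ → trans (sumℚ-cong (suc N) (λ a _ → regroup a l)) (sumℚ-*ˡ (suc N) (ω s l * ι (M C l)) (H l))) ⟩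
    sumℚ (suc M) (λ l → ω s l * ι (M C l) * sumℚ (suc N) (λ a → ι (p C (N ∸ a)) * ι ((M ∸ l) C a)))
      ≡⟨ sumℚ-cong (suc M) (λ l _ → cong (ω s l * ι (M C l) *_) (vandermonde (M ∸ l) p N)) ⟩
    sumℚ (suc M) (λ l → ω s l * ι (M C l) * ι (((M ∸ l) +ₙ p) C N)) ∎

-- For k = t + s and n = k + N this is binom(n - min(k - j, t), n - k) when j ≤ k (capped-index).
capped : ℕ → ℕ → ℕ → ℚ
capped s N j = ι (((s +ₙ N) +ₙ (j ∸ s)) C N)

expansion-term-vanishes : ∀ s N j l → 0 < N → j < s → ω s l * ι ((s +ₙ N) C l) * ι (((N +ₙ j) ∸ l) C N) ≡ 0ℚ
expansion-term-vanishes s N j l 0<N j<s with ℕP.≤-<-connex l s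
... | inj₁ l≤s = begin
  ω s l * ι (M C l) * ι (((N +ₙ j) ∸ l) C N)   ≡⟨ cong (λ x → x * ι (M C l) * ι (((N +ₙ j) ∸ l) C N)) (ω-vanish l≤s) ⟩
  0ℚ * ι (M C l) * ι (((N +ₙ j) ∸ l) C N)      ≡⟨ cong (_* ι (((N +ₙ j) ∸ l) C N)) (*-zeroˡ (ι (M C l))) ⟩
  0ℚ * ι (((N +ₙ j) ∸ l) C N)                  ≡⟨ *-zeroˡ (ι (((N +ₙ j) ∸ l) C N)) ⟩
  0ℚ                                           ∎
  where
  open ≡-Reasoning
  M : ℕ
  M = s +ₙ N
... | inj₂ s<l = begin
  ω s l * ι (M C l) * ι (((N +ₙ j) ∸ l) C N)   ≡⟨ cong (ω s l * ι (M C l) *_) (ι-nCk≡0 ([n+j]∸l<n N 0<N (ℕP.<-trans j<s s<l))) ⟩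
  ω s l * ι (M C l) * 0ℚ                       ≡⟨ *-zeroʳ (ω s l * ι (M C l)) ⟩
  0ℚ                                           ∎
  where
  open ≡-Reasoning
  M : ℕ
  M = s +ₙ N

capped-expansion-≥ : ∀ s N j → s ≤ j → let M = s +ₙ N in
  capped s N j ≡ ι (M C N) + sumℚ (suc M) (λ l → ω s l * ι (M C l) * ι (((N +ₙ j) ∸ l) C N))
capped-expansion-≥ s N j s≤j = trans (binomial-expansion s N (j ∸ s)) (cong (ι (M C N) +_) (sumℚ-cong (suc M) (λ l l<1+M →
  cong (λ x → ω s l * ι (M C l) * ι (x C N)) (shift (ℕP.≤-pred l<1+M)))))
  where
  M : ℕ
  M = s +ₙ N
  shift : ∀ {l} → l ≤ M → (M ∸ l) +ₙ (j ∸ s) ≡ (N +ₙ j) ∸ l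
  shift {l} l≤M = begin
    (M ∸ l) +ₙ (j ∸ s)      ≡⟨ ℕP.+-∸-comm (j ∸ s) l≤M ⟨
    (M +ₙ (j ∸ s)) ∸ l      ≡⟨ cong (_∸ l) (trans (ℕP.+-assoc s N (j ∸ s)) (ℕP.+-comm s (N +ₙ (j ∸ s)))) ⟩
    (N +ₙ (j ∸ s) +ₙ s) ∸ l ≡⟨ cong (_∸ l) (trans (ℕP.+-assoc N (j ∸ s) s) (cong (N +ₙ_) (ℕP.m∸n+n≡m s≤j))) ⟩
    (N +ₙ j) ∸ l            ∎
    where open ≡-Reasoning

capped-expansion-< : ∀ s N j → 0 < N → j < s → let M = s +ₙ N in
  capped s N j ≡ ι (M C N) + sumℚ (suc M) (λ l → ω s l * ι (M C l) * ι (((N +ₙ j) ∸ l) C N))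
capped-expansion-< s N j 0<N j<s = begin
  ι ((M +ₙ (j ∸ s)) C N)            ≡⟨ cong (λ x → ι ((M +ₙ x) C N)) (ℕP.m≤n⇒m∸n≡0 (ℕP.<⇒≤ j<s)) ⟩
  ι ((M +ₙ 0) C N)                  ≡⟨ cong (λ x → ι (x C N)) (ℕP.+-identityʳ M) ⟩
  ι (M C N)                         ≡⟨ +-identityʳ (ι (M C N)) ⟨
  ι (M C N) + 0ℚ                    ≡⟨ cong (ι (M C N) +_) (sumℚ-zero (suc M) {term} (λ l _ → expansion-term-vanishes s N j l 0<N j<s)) ⟨
  ι (M C N) + sumℚ (suc M) term     ∎
  where
  open ≡-Reasoning
  M : ℕ
  M = s +ₙ N
  term : ℕ → ℚ
  term l = ω s l * ι (M C l) * ι (((N +ₙ j) ∸ l) C N)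

capped-expansion : ∀ s N j → 0 < N → let M = s +ₙ N in
  capped s N j ≡ ι (M C N) + sumℚ (suc M) (λ l → ω s l * ι (M C l) * ι (((N +ₙ j) ∸ l) C N))
capped-expansion s N j 0<N = [ capped-expansion-≥ s N j , capped-expansion-< s N j 0<N ]′ (ℕP.≤-<-connex s j)

Δ-capped : ∀ s N r → 0 < r → r ≤ N → let M = s +ₙ N in
  Δ r (capped s N) ≡ sumℚ (suc N) (λ l → ω s l * ι (M C l) * ι ((N ∸ l) C (N ∸ r)))
Δ-capped s N (suc r) _ 1+r≤N = begin
  Δ (suc r) (capped s N)                                   ≡⟨ Δ-cong (suc r) (λ j _ → capped-expansion s N j 0<N) ⟩
  Δ (suc r) (λ j → ι (M C N) + sumℚ (suc M) (λ l → c l * b l j))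
                                                           ≡⟨ Δ-+ (suc r) (λ _ → ι (M C N)) (λ j → sumℚ (suc M) (λ l → c l * b l j)) ⟩
  Δ (suc r) (λ _ → ι (M C N)) + Δ (suc r) (λ j → sumℚ (suc M) (λ l → c l * b l j))
                                                           ≡⟨ cong₂ _+_ (Δ-const r (ι (M C N))) (Δ-sumℚ (suc r) (suc M) (λ l j → c l * b l j)) ⟩
  0ℚ + sumℚ (suc M) (λ l → Δ (suc r) (λ j → c l * b l j))  ≡⟨ +-identityˡ (sumℚ (suc M) (λ l → Δ (suc r) (λ j → c l * b l j))) ⟩
  sumℚ (suc M) (λ l → Δ (suc r) (λ j → c l * b l j))       ≡⟨ sumℚ-cong (suc M) (λ l _ → Δ-*ˡ (suc r) (c l) (b l)) ⟩
  sumℚ (suc M) (λ l → c l * Δ (suc r) (b l))               ≡⟨ sumℚ-truncate (s≤s (ℕP.m≤n+m N s)) beyond ⟩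
  sumℚ (suc N) (λ l → c l * Δ (suc r) (b l))               ≡⟨ sumℚ-cong (suc N) (λ l l<1+N → cong (c l *_) (Δ-within (ℕP.≤-pred l<1+N))) ⟩
  sumℚ (suc N) (λ l → c l * ι ((N ∸ l) C (N ∸ suc r)))     ∎
  where
  open ≡-Reasoning
  M : ℕ
  M = s +ₙ N
  0<N : 0 < N
  0<N = ℕP.<-≤-trans (s≤s z≤n) 1+r≤N
  c : ℕ → ℚ
  c l = ω s l * ι (M C l)
  b : ℕ → ℕ → ℚ
  b l j = ι (((N +ₙ j) ∸ l) C N)
  Δ-within : ∀ {l} → l ≤ N → Δ (suc r) (b l) ≡ ι ((N ∸ l) C (N ∸ suc r))
  Δ-within {l} l≤N = trans (Δ-cong (suc r) (λ j _ → cong ι (cong₂ _C_ (ℕP.+-∸-comm j l≤N) (sym (ℕP.m+[n∸m]≡n 1+r≤N)))))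
                           (Δ-binomial (suc r) (N ∸ suc r) (N ∸ l))
  beyond : ∀ l → N < l → c l * Δ (suc r) (b l) ≡ 0ℚ
  beyond l N<l = trans (cong (c l *_) (Δ-zero (suc r) b≡0)) (*-zeroʳ (c l))
    where
    b≡0 : ∀ j → j ≤ suc r → b l j ≡ 0ℚ
    b≡0 j j≤1+r = ι-nCk≡0 ([n+j]∸l<n N 0<N (ℕP.≤-<-trans (ℕP.≤-trans j≤1+r 1+r≤N) N<l))

-- The summand of Ω(n,k,t)_{F,G} with index i, in terms of l = k - i and r = k - |F ∩ G|.
Ωsummand : ℕ → ℕ → ℕ → ℕ → ℚ
Ωsummand s N r l = ω s l * invℕ (((s +ₙ N) ∸ l) C s) * ι (r C l)

binomial-cross : ∀ s N r l → r ≤ N → l ≤ N → let M = s +ₙ N in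
  (M C l) *ₙ ((N ∸ l) C (N ∸ r)) *ₙ ((M ∸ l) C s) ≡ (r C l) *ₙ ((M C s) *ₙ (N C r))
binomial-cross s N r l r≤N l≤N with ℕP.≤-<-connex l r
... | inj₁ l≤r = begin
  (M C l) *ₙ ((N ∸ l) C (N ∸ r)) *ₙ ((M ∸ l) C s)       ≡⟨ cong (λ x → (M C l) *ₙ x *ₙ ((M ∸ l) C s)) complement ⟩
  (M C l) *ₙ ((N ∸ l) C (r ∸ l)) *ₙ ((M ∸ l) C s)       ≡⟨ xy∙z≡xz∙y (M C l) ((N ∸ l) C (r ∸ l)) ((M ∸ l) C s) ⟩
  (M C l) *ₙ ((M ∸ l) C s) *ₙ ((N ∸ l) C (r ∸ l))       ≡⟨ cong (_*ₙ ((N ∸ l) C (r ∸ l))) (trinomial-revision-comm M l s) ⟩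
  (M C s) *ₙ ((M ∸ s) C l) *ₙ ((N ∸ l) C (r ∸ l))       ≡⟨ cong (λ x → (M C s) *ₙ (x C l) *ₙ ((N ∸ l) C (r ∸ l))) (ℕP.m+n∸m≡n s N) ⟩
  (M C s) *ₙ (N C l) *ₙ ((N ∸ l) C (r ∸ l))             ≡⟨ ℕP.*-assoc (M C s) (N C l) ((N ∸ l) C (r ∸ l)) ⟩
  (M C s) *ₙ ((N C l) *ₙ ((N ∸ l) C (r ∸ l)))           ≡⟨ cong ((M C s) *ₙ_) (subset-of-subset N r l l≤r) ⟨
  (M C s) *ₙ ((N C r) *ₙ (r C l))                       ≡⟨ x[yz]≡z[xy] (M C s) (N C r) (r C l) ⟩
  (r C l) *ₙ ((M C s) *ₙ (N C r))                       ∎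
  where
  open ≡-Reasoning
  M : ℕ
  M = s +ₙ N
  complement : (N ∸ l) C (N ∸ r) ≡ (N ∸ l) C (r ∸ l)
  complement = begin
    (N ∸ l) C (N ∸ r)                     ≡⟨ ℕC.nCk≡nC[n∸k] (ℕP.∸-monoʳ-≤ N l≤r) ⟩
    (N ∸ l) C ((N ∸ l) ∸ (N ∸ r))         ≡⟨ cong (λ x → (N ∸ l) C (x ∸ (N ∸ r))) split ⟩
    (N ∸ l) C (((N ∸ r) +ₙ (r ∸ l)) ∸ (N ∸ r)) ≡⟨ cong ((N ∸ l) C_) (ℕP.m+n∸m≡n (N ∸ r) (r ∸ l)) ⟩
    (N ∸ l) C (r ∸ l)                     ∎
    where
    split : N ∸ l ≡ (N ∸ r) +ₙ (r ∸ l)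
    split = trans (cong (_∸ l) (sym (ℕP.m∸n+n≡m r≤N))) (ℕP.+-∸-assoc (N ∸ r) l≤r)
  xy∙z≡xz∙y : ∀ x y z → x *ₙ y *ₙ z ≡ x *ₙ z *ₙ y
  xy∙z≡xz∙y = solve-∀ ℕ-ring
  x[yz]≡z[xy] : ∀ x y z → x *ₙ (y *ₙ z) ≡ z *ₙ (x *ₙ y)
  x[yz]≡z[xy] = solve-∀ ℕ-ring
... | inj₂ r<l = begin
  (M C l) *ₙ ((N ∸ l) C (N ∸ r)) *ₙ ((M ∸ l) C s)       ≡⟨ cong (λ x → (M C l) *ₙ x *ₙ ((M ∸ l) C s)) (ℕC.k>n⇒nCk≡0 (ℕP.∸-monoʳ-< r<l l≤N)) ⟩
  (M C l) *ₙ 0 *ₙ ((M ∸ l) C s)                         ≡⟨ cong (_*ₙ ((M ∸ l) C s)) (ℕP.*-zeroʳ (M C l)) ⟩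
  0                                                     ≡⟨ cong (_*ₙ ((M C s) *ₙ (N C r))) (ℕC.k>n⇒nCk≡0 r<l) ⟨
  (r C l) *ₙ ((M C s) *ₙ (N C r))                       ∎
  where
  open ≡-Reasoning
  M : ℕ
  M = s +ₙ N

normalise : ∀ s N r l → r ≤ N → l ≤ N → let M = s +ₙ N in
  invℕ (M C s) * invℕ (N C r) * (ω s l * ι (M C l) * ι ((N ∸ l) C (N ∸ r))) ≡ Ωsummand s N r l
normalise s N r l r≤N l≤N = begin
  invℕ (M C s) * invℕ (N C r) * (ω s l * ι (M C l) * ι ((N ∸ l) C (N ∸ r)))
    ≡⟨ xy∙[zu∙v]≡z∙[xy∙[uv]] (invℕ (M C s)) (invℕ (N C r)) (ω s l) (ι (M C l)) (ι ((N ∸ l) C (N ∸ r))) ⟩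
  ω s l * (invℕ (M C s) * invℕ (N C r) * (ι (M C l) * ι ((N ∸ l) C (N ∸ r))))
    ≡⟨ cong₂ (λ x y → ω s l * (x * y)) (invℕ-homo-* (M C s) (N C r)) (ι-homo-* (M C l) ((N ∸ l) C (N ∸ r))) ⟨
  ω s l * (invℕ ((M C s) *ₙ (N C r)) * ι ((M C l) *ₙ ((N ∸ l) C (N ∸ r))))
    ≡⟨ cong (ω s l *_) (invℕ*ι-cross ((M C s) *ₙ (N C r)) ((M ∸ l) C s) ((M C l) *ₙ ((N ∸ l) C (N ∸ r))) (r C l)
                                     0<MCs*NCr (k≤n⇒0<nCk s≤M∸l) (binomial-cross s N r l r≤N l≤N)) ⟩
  ω s l * (invℕ ((M ∸ l) C s) * ι (r C l))
    ≡⟨ *-assoc (ω s l) (invℕ ((M ∸ l) C s)) (ι (r C l)) ⟨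
  Ωsummand s N r l ∎
  where
  open ≡-Reasoning
  M : ℕ
  M = s +ₙ N
  0<MCs*NCr : 0 < (M C s) *ₙ (N C r)
  0<MCs*NCr = ℕP.*-mono-≤ (k≤n⇒0<nCk (ℕP.m≤m+n s N)) (k≤n⇒0<nCk r≤N)
  s≤M∸l : s ≤ M ∸ l
  s≤M∸l = subst (s ≤_) (sym (ℕP.+-∸-assoc s l≤N)) (ℕP.m≤m+n s (N ∸ l))
  xy∙[zu∙v]≡z∙[xy∙[uv]] : ∀ x y z u v → x * y * (z * u * v) ≡ z * (x * y * (u * v))
  xy∙[zu∙v]≡z∙[xy∙[uv]] = solve-∀ ℚ-ring

∣p∣+∣q∣≡∣p∪q∣+∣p∩q∣ : ∀ {n} (p q : Subset n) → ∣ p ∣ +ₙ ∣ q ∣ ≡ ∣ p ∪ q ∣ +ₙ ∣ p ∩ q ∣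
∣p∣+∣q∣≡∣p∪q∣+∣p∩q∣ []            []            = refl
∣p∣+∣q∣≡∣p∪q∣+∣p∩q∣ (inside  ∷ p) (inside  ∷ q) =
  cong suc (trans (ℕP.+-suc ∣ p ∣ ∣ q ∣) (trans (cong suc (∣p∣+∣q∣≡∣p∪q∣+∣p∩q∣ p q)) (sym (ℕP.+-suc ∣ p ∪ q ∣ ∣ p ∩ q ∣))))
∣p∣+∣q∣≡∣p∪q∣+∣p∩q∣ (inside  ∷ p) (outside ∷ q) = cong suc (∣p∣+∣q∣≡∣p∪q∣+∣p∩q∣ p q)
∣p∣+∣q∣≡∣p∪q∣+∣p∩q∣ (outside ∷ p) (inside  ∷ q) = trans (ℕP.+-suc ∣ p ∣ ∣ q ∣) (cong suc (∣p∣+∣q∣≡∣p∪q∣+∣p∩q∣ p q))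
∣p∣+∣q∣≡∣p∪q∣+∣p∩q∣ (outside ∷ p) (outside ∷ q) = ∣p∣+∣q∣≡∣p∪q∣+∣p∩q∣ p q

inter≤k : ∀ {n k} (F G : KSet n k) → inter F G ≤ k
inter≤k (F , ∣F∣≡k) (G , _) = subst (_ ≤_) ∣F∣≡k (∣p∩q∣≤∣p∣ F G)

k∸inter≤N : ∀ {k} N (F G : KSet (k +ₙ N) k) → k ∸ inter F G ≤ N
k∸inter≤N {k} N (F , ∣F∣≡k) (G , ∣G∣≡k) = ℕP.m≤n+o⇒m∸n≤o k ∣ F ∩ G ∣ (ℕP.+-cancelˡ-≤ k k (∣ F ∩ G ∣ +ₙ N) (begin
  k +ₙ k                          ≡⟨ cong₂ _+ₙ_ ∣F∣≡k ∣G∣≡k ⟨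
  ∣ F ∣ +ₙ ∣ G ∣                   ≡⟨ ∣p∣+∣q∣≡∣p∪q∣+∣p∩q∣ F G ⟩
  ∣ F ∪ G ∣ +ₙ ∣ F ∩ G ∣           ≤⟨ ℕP.+-monoˡ-≤ ∣ F ∩ G ∣ (∣p∣≤n (F ∪ G)) ⟩
  (k +ₙ N) +ₙ ∣ F ∩ G ∣            ≡⟨ x+y+z≡x+[z+y] k N ∣ F ∩ G ∣ ⟩
  k +ₙ (∣ F ∩ G ∣ +ₙ N)            ∎))
  where
  open ℕP.≤-Reasoning
  x+y+z≡x+[z+y] : ∀ x y z → x +ₙ y +ₙ z ≡ x +ₙ (z +ₙ y)
  x+y+z≡x+[z+y] = solve-∀ ℕ-ring

S≡sumℚ-𝟙 : ∀ n k t (F G : KSet n k) → t ≤ k →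
  S n k t F G ≡ sumℚ t (λ i → a n k t (k ∸ i) * invℕ ((k C (k ∸ i)) *ₙ ((n ∸ k) C (k ∸ i))) * 𝟙 (inter F G ℕ.≟ i))
S≡sumℚ-𝟙 n k t F G t≤k = sumℚ-cong t (λ i i<t →
  cong (λ x → a n k t (k ∸ i) * invℕ ((k C (k ∸ i)) *ₙ ((n ∸ k) C (k ∸ i))) * 𝟙 (inter F G ℕ.≟ x))
       (ℕP.m∸[m∸n]≡n (ℕP.≤-trans (ℕP.<⇒≤ i<t) t≤k)))

S≡0 : ∀ n k t (F G : KSet n k) → t ≤ inter F G → S n k t F G ≡ 0ℚ
S≡0 n k t F G t≤m = trans (S≡sumℚ-𝟙 n k t F G (ℕP.≤-trans t≤m (inter≤k F G))) (sumℚ-𝟙≢ t (inter F G) coeff t≤m)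
  where
  coeff : ℕ → ℚ
  coeff i = a n k t (k ∸ i) * invℕ ((k C (k ∸ i)) *ₙ ((n ∸ k) C (k ∸ i)))

Ω≡0 : ∀ n k t (F G : KSet n k) → t ≤ inter F G → Ω n k t F G ≡ 0ℚ
Ω≡0 n k t F G t≤m = sumℚ-zero t (λ i i<t →
  trans (cong (coeff i *_) (ι-nCk≡0 (ℕP.∸-monoʳ-< (ℕP.<-≤-trans i<t t≤m) (inter≤k F G)))) (*-zeroʳ (coeff i)))
  where
  coeff : ℕ → ℚ
  coeff i = neg1^ (t ∸ 1 ∸ i) * ι ((k ∸ 1 ∸ i) C (k ∸ t)) * invℕ (((n +ₙ i) ∸ (k +ₙ t)) C (k ∸ t))

capped-index : ∀ t s N j → j ≤ t +ₙ s → ((t +ₙ s) +ₙ N) ∸ (((t +ₙ s) ∸ j) ⊓ t) ≡ (s +ₙ N) +ₙ (j ∸ s)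
capped-index t s N j j≤k = [ below , above ]′ (ℕP.≤-<-connex j s)
  where
  open ≡-Reasoning
  k : ℕ
  k = t +ₙ s
  below : j ≤ s → (k +ₙ N) ∸ ((k ∸ j) ⊓ t) ≡ (s +ₙ N) +ₙ (j ∸ s)
  below j≤s = begin
    (k +ₙ N) ∸ ((k ∸ j) ⊓ t)    ≡⟨ cong ((k +ₙ N) ∸_) (ℕP.m≥n⇒m⊓n≡n (subst (t ≤_) (sym (ℕP.+-∸-assoc t j≤s)) (ℕP.m≤m+n t (s ∸ j)))) ⟩
    (k +ₙ N) ∸ t                ≡⟨ cong (_∸ t) (ℕP.+-assoc t s N) ⟩
    (t +ₙ (s +ₙ N)) ∸ t         ≡⟨ ℕP.m+n∸m≡n t (s +ₙ N) ⟩
    s +ₙ N                      ≡⟨ ℕP.+-identityʳ (s +ₙ N) ⟨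
    (s +ₙ N) +ₙ 0               ≡⟨ cong ((s +ₙ N) +ₙ_) (ℕP.m≤n⇒m∸n≡0 j≤s) ⟨
    (s +ₙ N) +ₙ (j ∸ s)         ∎
  above : s < j → (k +ₙ N) ∸ ((k ∸ j) ⊓ t) ≡ (s +ₙ N) +ₙ (j ∸ s)
  above s<j = begin
    (k +ₙ N) ∸ ((k ∸ j) ⊓ t)              ≡⟨ cong ((k +ₙ N) ∸_) (ℕP.m≤n⇒m⊓n≡m (ℕP.m≤n+o⇒m∸n≤o k j k≤j+t)) ⟩
    (k +ₙ N) ∸ (k ∸ j)                    ≡⟨ cong (λ x → (x +ₙ N) ∸ (k ∸ j)) (ℕP.m∸n+n≡m j≤k) ⟨
    ((k ∸ j) +ₙ j +ₙ N) ∸ (k ∸ j)         ≡⟨ cong (_∸ (k ∸ j)) (ℕP.+-assoc (k ∸ j) j N) ⟩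
    ((k ∸ j) +ₙ (j +ₙ N)) ∸ (k ∸ j)       ≡⟨ ℕP.m+n∸m≡n (k ∸ j) (j +ₙ N) ⟩
    j +ₙ N                                ≡⟨ cong (_+ₙ N) (ℕP.m+[n∸m]≡n (ℕP.<⇒≤ s<j)) ⟨
    s +ₙ (j ∸ s) +ₙ N                     ≡⟨ x+y+z≡x+z+y s (j ∸ s) N ⟩
    (s +ₙ N) +ₙ (j ∸ s)                   ∎
    where
    k≤j+t : k ≤ j +ₙ t
    k≤j+t = subst (_≤ j +ₙ t) (ℕP.+-comm s t) (ℕP.+-monoˡ-≤ t (ℕP.<⇒≤ s<j))
    x+y+z≡x+z+y : ∀ x y z → x +ₙ y +ₙ z ≡ x +ₙ z +ₙ y
    x+y+z≡x+z+y = solve-∀ ℕ-ring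

a≡Δ-capped : ∀ t s N r → r ≤ t +ₙ s → let k = t +ₙ s in
  a (k +ₙ N) k t r ≡ invℕ ((s +ₙ N) C s) * ι (k C r) * Δ r (capped s N)
a≡Δ-capped t s N r r≤k = begin
  invℕ ((n ∸ t) C (k ∸ t)) * ι (k C r) * Δ r f       ≡⟨ cong (λ x → invℕ x * ι (k C r) * Δ r f) (cong₂ _C_ n∸t≡M (ℕP.m+n∸m≡n t s)) ⟩
  invℕ (M C s) * ι (k C r) * Δ r f                   ≡⟨ cong (invℕ (M C s) * ι (k C r) *_) (Δ-cong r f≡capped) ⟩
  invℕ (M C s) * ι (k C r) * Δ r (capped s N)        ∎
  where
  open ≡-Reasoning
  k : ℕ
  k = t +ₙ s
  n : ℕ
  n = k +ₙ N
  M : ℕ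
  M = s +ₙ N
  n∸t≡M : n ∸ t ≡ M
  n∸t≡M = trans (cong (_∸ t) (ℕP.+-assoc t s N)) (ℕP.m+n∸m≡n t M)
  f : ℕ → ℚ
  f j = ι ((n ∸ ((k ∸ j) ⊓ t)) C (n ∸ k))
  f≡capped : ∀ j → j ≤ r → f j ≡ capped s N j
  f≡capped j j≤r = cong ι (cong₂ _C_ (capped-index t s N j (ℕP.≤-trans j≤r r≤k)) (ℕP.m+n∸m≡n k N))

S-entry : ∀ t s N (F G : KSet ((t +ₙ s) +ₙ N) (t +ₙ s)) → inter F G < t →
  S ((t +ₙ s) +ₙ N) (t +ₙ s) t F G ≡ sumℚ (suc N) (Ωsummand s N ((t +ₙ s) ∸ inter F G))
S-entry t s N F G m<t = begin
  S n k t F G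
    ≡⟨ S≡sumℚ-𝟙 n k t F G (ℕP.m≤m+n t s) ⟩
  sumℚ t (λ i → coeff i * 𝟙 (m ℕ.≟ i))
    ≡⟨ sumℚ-𝟙≡ t m coeff m<t ⟩
  a n k t r * invℕ ((k C r) *ₙ ((n ∸ k) C r))
    ≡⟨ cong₂ (λ x y → x * invℕ ((k C r) *ₙ (y C r))) (a≡Δ-capped t s N r r≤k) (ℕP.m+n∸m≡n k N) ⟩
  invℕ (M C s) * ι (k C r) * Δ r (capped s N) * invℕ ((k C r) *ₙ (N C r))
    ≡⟨ invℕ-cancel (invℕ (M C s)) (k C r) (N C r) (Δ r (capped s N)) (k≤n⇒0<nCk r≤k) ⟩
  invℕ (M C s) * invℕ (N C r) * Δ r (capped s N)
    ≡⟨ cong (invℕ (M C s) * invℕ (N C r) *_) (Δ-capped s N r (ℕP.m<n⇒0<n∸m m<k) r≤N) ⟩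
  invℕ (M C s) * invℕ (N C r) * sumℚ (suc N) expanded
    ≡⟨ sumℚ-*ˡ (suc N) (invℕ (M C s) * invℕ (N C r)) expanded ⟨
  sumℚ (suc N) (λ l → invℕ (M C s) * invℕ (N C r) * expanded l)
    ≡⟨ sumℚ-cong (suc N) (λ l l<1+N → normalise s N r l r≤N (ℕP.≤-pred l<1+N)) ⟩
  sumℚ (suc N) (Ωsummand s N r) ∎
  where
  open ≡-Reasoning
  k : ℕ
  k = t +ₙ s
  n : ℕ
  n = k +ₙ N
  M : ℕ
  M = s +ₙ N
  m : ℕ
  m = inter F G
  r : ℕ
  r = k ∸ m
  m<k : m < k
  m<k = ℕP.<-≤-trans m<t (ℕP.m≤m+n t s)
  r≤k : r ≤ k
  r≤k = ℕP.m∸n≤m k m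
  r≤N : r ≤ N
  r≤N = k∸inter≤N N F G
  coeff : ℕ → ℚ
  coeff i = a n k t (k ∸ i) * invℕ ((k C (k ∸ i)) *ₙ ((n ∸ k) C (k ∸ i)))
  expanded : ℕ → ℚ
  expanded l = ω s l * ι (M C l) * ι ((N ∸ l) C (N ∸ r))

Ω-summand-reindex : ∀ {t} i u s N r → suc (i +ₙ u) ≡ t → let k = t +ₙ s; n = k +ₙ N in
  neg1^ (t ∸ 1 ∸ i) * ι ((k ∸ 1 ∸ i) C (k ∸ t)) * invℕ (((n +ₙ i) ∸ (k +ₙ t)) C (k ∸ t)) * ι (r C (k ∸ i))
    ≡ Ωsummand s N r (k ∸ i)
Ω-summand-reindex {t} i u s N r refl = begin
  term (t ∸ 1 ∸ i) (k ∸ 1 ∸ i) (k ∸ t) ((n +ₙ i) ∸ (k +ₙ t)) (k ∸ i)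
    ≡⟨ term-cong (ℕP.m+n∸m≡n i u) (trans (cong (_∸ i) (ℕP.+-assoc i u s)) (ℕP.m+n∸m≡n i (u +ₙ s))) (ℕP.m+n∸m≡n t s) n+i∸[k+t] k∸i ⟩
  term u (u +ₙ s) s (N ∸ suc u) (suc (u +ₙ s))
    ≡⟨ term-cong (ℕP.m+n∸n≡m u s) (refl {x = u +ₙ s}) (refl {x = s}) M∸[1+u+s] (refl {x = suc (u +ₙ s)}) ⟨
  term ((u +ₙ s) ∸ s) (u +ₙ s) s ((s +ₙ N) ∸ suc (u +ₙ s)) (suc (u +ₙ s))
    ≡⟨⟩
  Ωsummand s N r (suc (u +ₙ s))
    ≡⟨ cong (Ωsummand s N r) k∸i ⟨
  Ωsummand s N r (k ∸ i) ∎
  where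
  open ≡-Reasoning
  k : ℕ
  k = t +ₙ s
  n : ℕ
  n = k +ₙ N
  term : ℕ → ℕ → ℕ → ℕ → ℕ → ℚ
  term e₁ e₂ e₃ e₄ e₅ = neg1^ e₁ * ι (e₂ C e₃) * invℕ (e₄ C e₃) * ι (r C e₅)
  term-cong : ∀ {e₁ e₂ e₃ e₄ e₅ e₁′ e₂′ e₃′ e₄′ e₅′} → e₁ ≡ e₁′ → e₂ ≡ e₂′ → e₃ ≡ e₃′ → e₄ ≡ e₄′ → e₅ ≡ e₅′ →
    term e₁ e₂ e₃ e₄ e₅ ≡ term e₁′ e₂′ e₃′ e₄′ e₅′
  term-cong refl refl refl refl refl = refl
  k∸i : k ∸ i ≡ suc (u +ₙ s)
  k∸i = trans (cong (_∸ i) (x+y+z≡x+[y+z] i u s)) (ℕP.m+n∸m≡n i (suc (u +ₙ s)))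
    where
    x+y+z≡x+[y+z] : ∀ x y z → suc (x +ₙ y) +ₙ z ≡ x +ₙ suc (y +ₙ z)
    x+y+z≡x+[y+z] = solve-∀ ℕ-ring
  n+i∸[k+t] : (n +ₙ i) ∸ (k +ₙ t) ≡ N ∸ suc u
  n+i∸[k+t] = begin
    (k +ₙ N +ₙ i) ∸ (k +ₙ t)            ≡⟨ cong (_∸ (k +ₙ t)) (ℕP.+-assoc k N i) ⟩
    (k +ₙ (N +ₙ i)) ∸ (k +ₙ t)          ≡⟨ ℕP.[m+n]∸[m+o]≡n∸o k (N +ₙ i) t ⟩
    (N +ₙ i) ∸ suc (i +ₙ u)             ≡⟨ cong₂ _∸_ (ℕP.+-comm N i) (sym (ℕP.+-suc i u)) ⟩
    (i +ₙ N) ∸ (i +ₙ suc u)             ≡⟨ ℕP.[m+n]∸[m+o]≡n∸o i N (suc u) ⟩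
    N ∸ suc u                           ∎
  M∸[1+u+s] : (s +ₙ N) ∸ suc (u +ₙ s) ≡ N ∸ suc u
  M∸[1+u+s] = trans (cong ((s +ₙ N) ∸_) (trans (cong suc (ℕP.+-comm u s)) (sym (ℕP.+-suc s u)))) (ℕP.[m+n]∸[m+o]≡n∸o s N (suc u))

Ω-entry : ∀ t s N (F G : KSet ((t +ₙ s) +ₙ N) (t +ₙ s)) →
  Ω ((t +ₙ s) +ₙ N) (t +ₙ s) t F G ≡ sumℚ t (λ i → Ωsummand s N ((t +ₙ s) ∸ inter F G) ((t +ₙ s) ∸ i))
Ω-entry t s N F G = sumℚ-cong t (λ i i<t → Ω-summand-reindex i (t ∸ suc i) s N ((t +ₙ s) ∸ inter F G) (ℕP.m+[n∸m]≡n i<t))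

sumℚ-Ωsummand : ∀ t s N r → r ≤ N → r ≤ t +ₙ s →
  sumℚ (suc N) (Ωsummand s N r) ≡ sumℚ t (λ i → Ωsummand s N r ((t +ₙ s) ∸ i))
sumℚ-Ωsummand t s N r r≤N r≤k = begin
  sumℚ (suc N) h                                     ≡⟨ sumℚ-truncate (s≤s r≤N) beyond ⟩
  sumℚ (suc r) h                                     ≡⟨ sumℚ-truncate (s≤s r≤k) beyond ⟨
  sumℚ (suc (t +ₙ s)) h                              ≡⟨ cong (λ x → sumℚ (suc x) h) (ℕP.+-comm t s) ⟩
  sumℚ (suc s +ₙ t) h                                ≡⟨ sumℚ-+ₙ (suc s) t h ⟩
  sumℚ (suc s) h + sumℚ t (λ i → h (suc s +ₙ i))     ≡⟨ cong (_+ sumℚ t (λ i → h (suc s +ₙ i))) (sumℚ-zero (suc s) {h} below) ⟩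
  0ℚ + sumℚ t (λ i → h (suc s +ₙ i))                 ≡⟨ +-identityˡ (sumℚ t (λ i → h (suc s +ₙ i))) ⟩
  sumℚ t (λ i → h (suc s +ₙ i))                      ≡⟨ sumℚ-reverse t (λ i → h (suc s +ₙ i)) ⟩
  sumℚ t (λ i → h (suc s +ₙ (t ∸ suc i)))            ≡⟨ sumℚ-cong t (λ i i<t → cong h (index i<t)) ⟩
  sumℚ t (λ i → h ((t +ₙ s) ∸ i))                    ∎
  where
  open ≡-Reasoning
  h : ℕ → ℚ
  h = Ωsummand s N r
  beyond : ∀ l → r < l → h l ≡ 0ℚ
  beyond l r<l = trans (cong (ω s l * invℕ (((s +ₙ N) ∸ l) C s) *_) (ι-nCk≡0 r<l)) (*-zeroʳ (ω s l * invℕ (((s +ₙ N) ∸ l) C s)))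
  below : ∀ l → l < suc s → h l ≡ 0ℚ
  below l l<1+s = begin
    ω s l * invℕ (((s +ₙ N) ∸ l) C s) * ι (r C l)  ≡⟨ cong (λ x → x * invℕ (((s +ₙ N) ∸ l) C s) * ι (r C l)) (ω-vanish (ℕP.≤-pred l<1+s)) ⟩
    0ℚ * invℕ (((s +ₙ N) ∸ l) C s) * ι (r C l)     ≡⟨ cong (_* ι (r C l)) (*-zeroˡ (invℕ (((s +ₙ N) ∸ l) C s))) ⟩
    0ℚ * ι (r C l)                                 ≡⟨ *-zeroˡ (ι (r C l)) ⟩
    0ℚ                                             ∎
  index : ∀ {i} → i < t → suc s +ₙ (t ∸ suc i) ≡ (t +ₙ s) ∸ i
  index {i} i<t = begin
    suc s +ₙ (t ∸ suc i)      ≡⟨ cong suc (ℕP.+-comm s (t ∸ suc i)) ⟩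
    suc (t ∸ suc i) +ₙ s      ≡⟨ cong (_+ₙ s) (ℕP.+-∸-assoc 1 i<t) ⟨
    (t ∸ i) +ₙ s              ≡⟨ ℕP.+-∸-comm s (ℕP.<⇒≤ i<t) ⟨
    (t +ₙ s) ∸ i              ∎

S≡Ω : ∀ t s N (F G : KSet ((t +ₙ s) +ₙ N) (t +ₙ s)) → S ((t +ₙ s) +ₙ N) (t +ₙ s) t F G ≡ Ω ((t +ₙ s) +ₙ N) (t +ₙ s) t F G
S≡Ω t s N F G = [ both-vanish , via-Ωsummand ]′ (ℕP.≤-<-connex t (inter F G))
  where
  k : ℕ
  k = t +ₙ s
  n : ℕ
  n = k +ₙ N
  both-vanish : t ≤ inter F G → S n k t F G ≡ Ω n k t F G
  both-vanish t≤m = trans (S≡0 n k t F G t≤m) (sym (Ω≡0 n k t F G t≤m))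
  via-Ωsummand : inter F G < t → S n k t F G ≡ Ω n k t F G
  via-Ωsummand m<t = begin
    S n k t F G                                                 ≡⟨ S-entry t s N F G m<t ⟩
    sumℚ (suc N) (Ωsummand s N (k ∸ inter F G))                 ≡⟨ sumℚ-Ωsummand t s N (k ∸ inter F G) (k∸inter≤N N F G) (ℕP.m∸n≤m k (inter F G)) ⟩
    sumℚ t (λ i → Ωsummand s N (k ∸ inter F G) (k ∸ i))         ≡⟨ Ω-entry t s N F G ⟨
    Ω n k t F G                                                 ∎
    where open ≡-Reasoning

theorem2 : ∀ n k t → 0 < t → t < k → k < n →
    ∀ (F G : KSet n k) → S n k t F G ≡ Ω n k t F G
theorem2 n k t _ t<k k<n = reparametrise (ℕP.m+[n∸m]≡n (ℕP.<⇒≤ t<k)) (ℕP.m+[n∸m]≡n (ℕP.<⇒≤ k<n))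
  where
  reparametrise : ∀ {n′ k′ s N} → t +ₙ s ≡ k′ → k′ +ₙ N ≡ n′ → (F G : KSet n′ k′) → S n′ k′ t F G ≡ Ω n′ k′ t F G
  reparametrise refl refl = S≡Ω t _ _
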